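{- Let $(\mathcal C,\otimes,I,\gamma)$ be a symmetric monoidal category and $(\mathcal T,\eta,\mu,\tau)$ a strong monad on it with right strength $\tau'$. Let $f:X\to\mathcal TY$ be a morphism in $\mathcal C$. Then the pair $(X,f)$ is a central cone of $\mathcal T$ at $Y$ if and only if $f$ is central in the Kleisli category $\mathcal C_{\mathcal T}$ in the premonoidal sense.
   Context: Left strength $\tau_{X,Y}:X\otimes\mathcal TY\to\mathcal T(X\otimes Y)$; right strength $\tau'_{X,Y}=\mathcal T(\gamma_{Y,X})\circ\tau_{Y,X}\circ\gamma_{\mathcal TX,Y}$. A central cone of $\mathcal T$ at an object $X$ is a pair $(Z,\iota)$ with $\iota:Z\to\mathcal TX$ such that for every object $Y$, $\mu_{X\otimes Y}\circ\mathcal T\tau'_{X,Y}\circ\tau_{\mathcal TX,Y}\circ(\iota\otimes\mathcal TY)=\mu_{X\otimes Y}\circ\mathcal T\tau_{X,Y}\circ\tau'_{X,\mathcal TY}\circ(\iota\otimes\mathcal TY)$ as morphisms $Z\otimes\mathcal TY\to\mathcal T(X\otimes Y)$. The Kleisli category $\mathcal C_{\mathcal T}$ has morphisms $X\to\mathcal TY$, composition $g\odot f=\mu\circ\mathcal Tg\circ f$. For $f:Y\to\mathcal TZ$ set $f\otimes_l X=\tau'_{Z,X}\circ(f\otimes X)$ and $X\otimes_r f=\tau_{X,Z}\circ(X\otimes f)$. A Kleisli morphism $f:X\to\mathcal TY$ is central (in the premonoidal sense) if for every $f':X'\to\mathcal TY'$, $(f\otimes_l Y')\odot(X\otimes_r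 f')=(Y\otimes_r f')\odot(f\otimes_l X')$. -}

module Defs where

open import Level using (Level; _⊔_) renaming (suc to lsuc)
open import Relation.Binary using (Rel; IsEquivalence)

record Category (o ℓ e : Level) : Set (lsuc (o ⊔ ℓ ⊔ e)) where
  infixr 9 _∘_
  infix  4 _≈_
  field
    Obj       : Set o
    _⇒_       : Obj → Obj → Set ℓ
    _≈_       : ∀ {A B} → Rel (A ⇒ B) e
    id        : ∀ {A} → A ⇒ A
    _∘_       : ∀ {A B C} → B ⇒ C → A ⇒ B → A ⇒ C
    equiv     : ∀ {A B} → IsEquivalence (_≈_ {A} {B})
    ∘-resp-≈  : ∀ {A B C} {f h : B ⇒ C} {g i : A ⇒ B} → f ≈ h → g ≈ i → f ∘ g ≈ h ∘ i
    assoc     : ∀ {A B C D} {f : A ⇒ B} {g : B ⇒ C} {h : C ⇒ D} → (h ∘ g) ∘ f ≈ h ∘ (g ∘ f)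
    identityˡ : ∀ {A B} {f : A ⇒ B} → id ∘ f ≈ f
    identityʳ : ∀ {A B} {f : A ⇒ B} → f ∘ id ≈ f

record SymmetricMonoidal {o ℓ e} (C : Category o ℓ e) : Set (o ⊔ ℓ ⊔ e) where
  open Category C
  infixr 10 _⊗₀_ _⊗₁_
  field
    _⊗₀_ : Obj → Obj → Obj
    _⊗₁_ : ∀ {A B C D} → A ⇒ B → C ⇒ D → (A ⊗₀ C) ⇒ (B ⊗₀ D)
    ⊗-identity     : ∀ {A B} → (id {A} ⊗₁ id {B}) ≈ id
    ⊗-homomorphism : ∀ {A B C D E F} {f : A ⇒ B} {g : B ⇒ C} {h : D ⇒ E} {k : E ⇒ F}
                     → ((g ∘ f) ⊗₁ (k ∘ h)) ≈ (g ⊗₁ k) ∘ (f ⊗₁ h)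
    ⊗-resp-≈       : ∀ {A B C D} {f g : A ⇒ B} {h k : C ⇒ D} → f ≈ g → h ≈ k → (f ⊗₁ h) ≈ (g ⊗₁ k)
    unit : Obj
    λ⇒ : ∀ {A} → (unit ⊗₀ A) ⇒ A
    λ⇐ : ∀ {A} → A ⇒ (unit ⊗₀ A)
    λ-isoˡ : ∀ {A} → λ⇐ {A} ∘ λ⇒ ≈ id
    λ-isoʳ : ∀ {A} → λ⇒ {A} ∘ λ⇐ ≈ id
    λ-natural : ∀ {A B} {f : A ⇒ B} → f ∘ λ⇒ ≈ λ⇒ ∘ (id ⊗₁ f)
    ρ⇒ : ∀ {A} → (A ⊗₀ unit) ⇒ A
    ρ⇐ : ∀ {A} → A ⇒ (A ⊗₀ unit)
    ρ-isoˡ : ∀ {A} → ρ⇐ {A} ∘ ρ⇒ ≈ id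
    ρ-isoʳ : ∀ {A} → ρ⇒ {A} ∘ ρ⇐ ≈ id
    ρ-natural : ∀ {A B} {f : A ⇒ B} → f ∘ ρ⇒ ≈ ρ⇒ ∘ (f ⊗₁ id)
    α⇒ : ∀ {A B C} → ((A ⊗₀ B) ⊗₀ C) ⇒ (A ⊗₀ (B ⊗₀ C))
    α⇐ : ∀ {A B C} → (A ⊗₀ (B ⊗₀ C)) ⇒ ((A ⊗₀ B) ⊗₀ C)
    α-isoˡ : ∀ {A B C} → α⇐ {A} {B} {C} ∘ α⇒ ≈ id
    α-isoʳ : ∀ {A B C} → α⇒ {A} {B} {C} ∘ α⇐ ≈ id
    α-natural : ∀ {A B C D E F} {f : A ⇒ B} {g : C ⇒ D} {h : E ⇒ F}
                → α⇒ ∘ ((f ⊗₁ g) ⊗₁ h) ≈ (f ⊗₁ (g ⊗₁ h)) ∘ α⇒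
    triangle : ∀ {A B} → (id {A} ⊗₁ λ⇒ {B}) ∘ α⇒ ≈ (ρ⇒ ⊗₁ id)
    pentagon : ∀ {A B C D} → (id {A} ⊗₁ α⇒ {B} {C} {D}) ∘ α⇒ ∘ (α⇒ ⊗₁ id {D})
                             ≈ α⇒ {A} {B} {C ⊗₀ D} ∘ α⇒ {A ⊗₀ B} {C} {D}
    γ : ∀ {A B} → (A ⊗₀ B) ⇒ (B ⊗₀ A)
    γ-natural : ∀ {A B C D} {f : A ⇒ B} {g : C ⇒ D} → γ ∘ (f ⊗₁ g) ≈ (g ⊗₁ f) ∘ γ
    γ-commutative : ∀ {A B} → γ {B} {A} ∘ γ {A} {B} ≈ id
    hexagon : ∀ {A B C} → α⇒ {B} {C} {A} ∘ γ {A} {B ⊗₀ C} ∘ α⇒ {A} {B} {C}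
                          ≈ (id ⊗₁ γ {A} {C}) ∘ α⇒ {B} {A} {C} ∘ (γ {A} {B} ⊗₁ id)

record StrongMonad {o ℓ e} (C : Category o ℓ e) (M : SymmetricMonoidal C) : Set (o ⊔ ℓ ⊔ e) where
  open Category C
  open SymmetricMonoidal M
  field
    T₀ : Obj → Obj
    T₁ : ∀ {A B} → A ⇒ B → T₀ A ⇒ T₀ B
    T-identity     : ∀ {A} → T₁ (id {A}) ≈ id
    T-homomorphism : ∀ {A B C} {f : A ⇒ B} {g : B ⇒ C} → T₁ (g ∘ f) ≈ T₁ g ∘ T₁ f
    T-resp-≈       : ∀ {A B} {f g : A ⇒ B} → f ≈ g → T₁ f ≈ T₁ g
    η : ∀ {A} → A ⇒ T₀ A
    μ : ∀ {A} → T₀ (T₀ A) ⇒ T₀ A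
    η-natural : ∀ {A B} {f : A ⇒ B} → T₁ f ∘ η ≈ η ∘ f
    μ-natural : ∀ {A B} {f : A ⇒ B} → T₁ f ∘ μ ≈ μ ∘ T₁ (T₁ f)
    μ-assoc     : ∀ {A} → μ {A} ∘ T₁ μ ≈ μ ∘ μ
    μ-identityˡ : ∀ {A} → μ {A} ∘ T₁ η ≈ id
    μ-identityʳ : ∀ {A} → μ {A} ∘ η ≈ id
    τ : ∀ {A B} → (A ⊗₀ T₀ B) ⇒ T₀ (A ⊗₀ B)
    τ-natural : ∀ {A B C D} {f : A ⇒ B} {g : C ⇒ D} → T₁ (f ⊗₁ g) ∘ τ ≈ τ ∘ (f ⊗₁ T₁ g)
    τ-λ : ∀ {A} → T₁ λ⇒ ∘ τ {unit} {A} ≈ λ⇒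
    τ-α : ∀ {A B C} → T₁ (α⇒ {A} {B} {C}) ∘ τ {A ⊗₀ B} {C} ≈ τ ∘ (id ⊗₁ τ) ∘ α⇒
    τ-η : ∀ {A B} → τ {A} {B} ∘ (id ⊗₁ η) ≈ η
    τ-μ : ∀ {A B} → τ {A} {B} ∘ (id ⊗₁ μ) ≈ μ ∘ T₁ τ ∘ τ

module _ {o ℓ e} {C : Category o ℓ e} {M : SymmetricMonoidal C} (T : StrongMonad C M) where
  open Category C
  open SymmetricMonoidal M
  open StrongMonad T

  τ′ : ∀ {X Y} → (T₀ X ⊗₀ Y) ⇒ T₀ (X ⊗₀ Y)
  τ′ {X} {Y} = T₁ (γ {Y} {X}) ∘ τ {Y} {X} ∘ γ {T₀ X} {Y}

  _⊙_ : ∀ {A B D} → B ⇒ T₀ D → A ⇒ T₀ B → A ⇒ T₀ D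
  g ⊙ f = μ ∘ T₁ g ∘ f

  _⊗ₗ_ : ∀ {Y Z} → Y ⇒ T₀ Z → (X : Obj) → (Y ⊗₀ X) ⇒ T₀ (Z ⊗₀ X)
  f ⊗ₗ X = τ′ ∘ (f ⊗₁ id {X})

  _⊗ᵣ_ : ∀ {Y Z} → (X : Obj) → Y ⇒ T₀ Z → (X ⊗₀ Y) ⇒ T₀ (X ⊗₀ Z)
  X ⊗ᵣ f = τ ∘ (id {X} ⊗₁ f)

  CentralCone : (X Z : Obj) → Z ⇒ T₀ X → Set (o ⊔ e)
  CentralCone X Z ι =
    ∀ (Y : Obj) →
      μ {X ⊗₀ Y} ∘ T₁ (τ′ {X} {Y}) ∘ τ {T₀ X} {Y} ∘ (ι ⊗₁ id {T₀ Y})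
      ≈ μ {X ⊗₀ Y} ∘ T₁ (τ {X} {Y}) ∘ τ′ {X} {T₀ Y} ∘ (ι ⊗₁ id {T₀ Y})

  KleisliCentral : ∀ {X Y} → X ⇒ T₀ Y → Set (o ⊔ ℓ ⊔ e)
  KleisliCentral {X} {Y} f =
    ∀ {X′ Y′ : Obj} (f′ : X′ ⇒ T₀ Y′) →
      (f ⊗ₗ Y′) ⊙ (X ⊗ᵣ f′) ≈ (Y ⊗ᵣ f′) ⊙ (f ⊗ₗ X′)

{-# OPTIONS --safe #-}
-- By naturality of the strengths, the two Kleisli composites in the centrality
-- square of f and f′ are the two double strengths μ ∘ T τ′ ∘ τ and μ ∘ T τ ∘ τ′
-- precomposed with f ⊗ f′. As f ⊗ f′ = (f ⊗ id) ∘ (id ⊗ f′), the cone condition,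
-- which says that they agree after f ⊗ id, makes them agree after every f ⊗ f′;
-- conversely, centrality against f′ = id is exactly the cone condition.
module Submission where

open import Defs
open import Function.Bundles using (_⇔_; mk⇔)
open import Relation.Binary.Bundles using (Setoid)
open import Relation.Binary.Structures using (IsEquivalence)
import Relation.Binary.Reasoning.Setoid as SetoidReasoning

module HomReasoning {o ℓ e} (C : Category o ℓ e) where
  open Category C

  module _ {A B : Obj} where
    open IsEquivalence (equiv {A} {B}) public using (refl; sym; trans)

  hom-setoid : Obj → Obj → Setoid ℓ e
  hom-setoid A B = record { Carrier = A ⇒ B ; _≈_ = _≈_ ; isEquivalence = equiv }

  module ≈-Reasoning {A B : Obj} = SetoidReasoning (hom-setoid A B)

  infixr 4 refl⟩∘⟨_
  infixl 5 _⟩∘⟨refl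

  refl⟩∘⟨_ : ∀ {A B D} {f : B ⇒ D} {g i : A ⇒ B} → g ≈ i → f ∘ g ≈ f ∘ i
  refl⟩∘⟨ p = ∘-resp-≈ refl p

  _⟩∘⟨refl : ∀ {A B D} {f h : B ⇒ D} {g : A ⇒ B} → f ≈ h → f ∘ g ≈ h ∘ g
  p ⟩∘⟨refl = ∘-resp-≈ p refl

  assoc² : ∀ {A B D E F} {a : E ⇒ F} {b : D ⇒ E} {c : B ⇒ D} {d : A ⇒ B}
           → (a ∘ b ∘ c) ∘ d ≈ a ∘ b ∘ c ∘ d
  assoc² = trans assoc (refl⟩∘⟨ assoc)

  extend : ∀ {A B B′ D E} {a : B ⇒ E} {b : D ⇒ B} {c : B′ ⇒ E} {d : D ⇒ B′} {x : A ⇒ D}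
           → a ∘ b ≈ c ∘ d → a ∘ b ∘ x ≈ c ∘ d ∘ x
  extend p = trans (sym assoc) (trans (p ⟩∘⟨refl) assoc)

module MonoidalReasoning {o ℓ e} {C : Category o ℓ e} (M : SymmetricMonoidal C) where
  open Category C
  open SymmetricMonoidal M
  open HomReasoning C

  serialize₁₂ : ∀ {A B D E} {f : A ⇒ B} {g : D ⇒ E} → f ⊗₁ g ≈ (f ⊗₁ id) ∘ (id ⊗₁ g)
  serialize₁₂ = trans (⊗-resp-≈ (sym identityʳ) (sym identityˡ)) ⊗-homomorphism

  serialize₂₁ : ∀ {A B D E} {f : A ⇒ B} {g : D ⇒ E} → f ⊗₁ g ≈ (id ⊗₁ g) ∘ (f ⊗₁ id)
  serialize₂₁ = trans (⊗-resp-≈ (sym identityˡ) (sym identityʳ)) ⊗-homomorphism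

module Centrality {o ℓ e} {C : Category o ℓ e} {M : SymmetricMonoidal C} (T : StrongMonad C M) where
  open Category C
  open SymmetricMonoidal M
  open StrongMonad T
  open HomReasoning C
  open MonoidalReasoning M

  τ-natural₁ : ∀ {A B D} {f : A ⇒ B} → T₁ (f ⊗₁ id {D}) ∘ τ ≈ τ ∘ (f ⊗₁ id)
  τ-natural₁ = trans τ-natural (refl⟩∘⟨ ⊗-resp-≈ refl T-identity)

  τ′-natural₂ : ∀ {A B D} {g : A ⇒ B} → T₁ (id {D} ⊗₁ g) ∘ τ′ T ≈ τ′ T ∘ (id ⊗₁ g)
  τ′-natural₂ {g = g} = begin
    T₁ (id ⊗₁ g) ∘ τ′ T           ≈⟨ extend T-γ-swap ⟩
    T₁ γ ∘ T₁ (g ⊗₁ id) ∘ τ ∘ γ   ≈⟨ refl⟩∘⟨ extend τ-natural₁ ⟩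
    T₁ γ ∘ τ ∘ (g ⊗₁ id) ∘ γ      ≈⟨ refl⟩∘⟨ refl⟩∘⟨ sym γ-natural ⟩
    T₁ γ ∘ τ ∘ γ ∘ (id ⊗₁ g)      ≈⟨ sym assoc² ⟩
    τ′ T ∘ (id ⊗₁ g)              ∎
    where
      open ≈-Reasoning
      T-γ-swap : T₁ (id ⊗₁ g) ∘ T₁ γ ≈ T₁ γ ∘ T₁ (g ⊗₁ id)
      T-γ-swap = trans (sym T-homomorphism)
                       (trans (T-resp-≈ (sym γ-natural)) T-homomorphism)

  dstr : ∀ {A B} → (T₀ A ⊗₀ T₀ B) ⇒ T₀ (A ⊗₀ B)
  dstr = μ ∘ T₁ (τ′ T) ∘ τ

  dstr′ : ∀ {A B} → (T₀ A ⊗₀ T₀ B) ⇒ T₀ (A ⊗₀ B)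
  dstr′ = μ ∘ T₁ τ ∘ τ′ T

  module _ {A B A′ B′} (f : A ⇒ T₀ B) (g : A′ ⇒ T₀ B′) where
    open ≈-Reasoning

    ⊗ₗ⊙⊗ᵣ≈dstr : _⊙_ T (_⊗ₗ_ T f B′) (_⊗ᵣ_ T A g) ≈ dstr ∘ (f ⊗₁ g)
    ⊗ₗ⊙⊗ᵣ≈dstr = begin
      μ ∘ T₁ (τ′ T ∘ (f ⊗₁ id)) ∘ τ ∘ (id ⊗₁ g)     ≈⟨ refl⟩∘⟨ T-homomorphism ⟩∘⟨refl ⟩
      μ ∘ (T₁ (τ′ T) ∘ T₁ (f ⊗₁ id)) ∘ τ ∘ (id ⊗₁ g) ≈⟨ refl⟩∘⟨ assoc ⟩
      μ ∘ T₁ (τ′ T) ∘ T₁ (f ⊗₁ id) ∘ τ ∘ (id ⊗₁ g)   ≈⟨ refl⟩∘⟨ refl⟩∘⟨ extend τ-natural₁ ⟩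
      μ ∘ T₁ (τ′ T) ∘ τ ∘ (f ⊗₁ id) ∘ (id ⊗₁ g)      ≈⟨ refl⟩∘⟨ refl⟩∘⟨ refl⟩∘⟨ sym serialize₁₂ ⟩
      μ ∘ T₁ (τ′ T) ∘ τ ∘ (f ⊗₁ g)                   ≈⟨ sym assoc² ⟩
      dstr ∘ (f ⊗₁ g)                                ∎

    ⊗ᵣ⊙⊗ₗ≈dstr′ : _⊙_ T (_⊗ᵣ_ T B g) (_⊗ₗ_ T f A′) ≈ dstr′ ∘ (f ⊗₁ g)
    ⊗ᵣ⊙⊗ₗ≈dstr′ = begin
      μ ∘ T₁ (τ ∘ (id ⊗₁ g)) ∘ τ′ T ∘ (f ⊗₁ id)     ≈⟨ refl⟩∘⟨ T-homomorphism ⟩∘⟨refl ⟩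
      μ ∘ (T₁ τ ∘ T₁ (id ⊗₁ g)) ∘ τ′ T ∘ (f ⊗₁ id)  ≈⟨ refl⟩∘⟨ assoc ⟩
      μ ∘ T₁ τ ∘ T₁ (id ⊗₁ g) ∘ τ′ T ∘ (f ⊗₁ id)    ≈⟨ refl⟩∘⟨ refl⟩∘⟨ extend τ′-natural₂ ⟩
      μ ∘ T₁ τ ∘ τ′ T ∘ (id ⊗₁ g) ∘ (f ⊗₁ id)       ≈⟨ refl⟩∘⟨ refl⟩∘⟨ refl⟩∘⟨ sym serialize₂₁ ⟩
      μ ∘ T₁ τ ∘ τ′ T ∘ (f ⊗₁ g)                    ≈⟨ sym assoc² ⟩
      dstr′ ∘ (f ⊗₁ g)                              ∎

  module _ {X Y} (f : X ⇒ T₀ Y) where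
    open ≈-Reasoning

    centralCone⇒dstr-agree : CentralCone T Y X f → ∀ {X′ Y′} (g : X′ ⇒ T₀ Y′)
                             → dstr ∘ (f ⊗₁ g) ≈ dstr′ ∘ (f ⊗₁ g)
    centralCone⇒dstr-agree cone {Y′ = Y′} g = begin
      dstr ∘ (f ⊗₁ g)                 ≈⟨ refl⟩∘⟨ serialize₁₂ ⟩
      dstr ∘ (f ⊗₁ id) ∘ (id ⊗₁ g)    ≈⟨ sym assoc ⟩
      (dstr ∘ (f ⊗₁ id)) ∘ (id ⊗₁ g)  ≈⟨ trans assoc² (trans (cone Y′) (sym assoc²)) ⟩∘⟨refl ⟩
      (dstr′ ∘ (f ⊗₁ id)) ∘ (id ⊗₁ g) ≈⟨ assoc ⟩
      dstr′ ∘ (f ⊗₁ id) ∘ (id ⊗₁ g)   ≈⟨ refl⟩∘⟨ sym serialize₁₂ ⟩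
      dstr′ ∘ (f ⊗₁ g)                ∎

    centralCone⇒kleisliCentral : CentralCone T Y X f → KleisliCentral T f
    centralCone⇒kleisliCentral cone g =
      trans (⊗ₗ⊙⊗ᵣ≈dstr f g)
            (trans (centralCone⇒dstr-agree cone g) (sym (⊗ᵣ⊙⊗ₗ≈dstr′ f g)))

    kleisliCentral⇒centralCone : KleisliCentral T f → CentralCone T Y X f
    kleisliCentral⇒centralCone central Y′ = begin
      μ ∘ T₁ (τ′ T) ∘ τ ∘ (f ⊗₁ id)         ≈⟨ sym assoc² ⟩
      dstr ∘ (f ⊗₁ id)                      ≈⟨ sym (⊗ₗ⊙⊗ᵣ≈dstr f id) ⟩
      _⊙_ T (_⊗ₗ_ T f _) (_⊗ᵣ_ T X id)      ≈⟨ central (id {T₀ Y′}) ⟩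
      _⊙_ T (_⊗ᵣ_ T Y id) (_⊗ₗ_ T f _)      ≈⟨ ⊗ᵣ⊙⊗ₗ≈dstr′ f id ⟩
      dstr′ ∘ (f ⊗₁ id)                     ≈⟨ assoc² ⟩
      μ ∘ T₁ τ ∘ τ′ T ∘ (f ⊗₁ id)           ∎

proposition2p4 : ∀ {o ℓ e} (C : Category o ℓ e) (M : SymmetricMonoidal C) (T : StrongMonad C M)
                   {X Y : Category.Obj C} (f : Category._⇒_ C X (StrongMonad.T₀ T Y))
                   → CentralCone T Y X f ⇔ KleisliCentral T f
proposition2p4 C M T f =
  mk⇔ (centralCone⇒kleisliCentral f) (kleisliCentral⇒centralCone f)
  where open Centrality T
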